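{- For every permutation $\pi$ of length $n$ and every integer $0\le k\le n$, we have $P(\pi)\vert_k \in T(\pi\vert_k)$.
   Context: A permutation of length $n$ is a word over $\{1,\dots,n\}$ in which each symbol occurs exactly once. The pop-stack operator $P$ is defined by: write $\pi=\pi_1\cdots\pi_\ell$ where $\pi_1,\dots,\pi_\ell$ are the maximal decreasing runs (maximal contiguous decreasing factors) of $\pi$; then $P(\pi)=\pi_1^{\mathrm r}\cdots\pi_\ell^{\mathrm r}$, where $w^{\mathrm r}$ denotes the reversal of the word $w$. For a permutation $\pi$ of length $n$ and integer $0\le k\le n$, $\pi\vert_k$ is the binary word of length $n$ with $\pi\vert_k(i)=0$ if $\pi(i)<k$ and $\pi\vert_k(i)=1$ if $\pi(i)\ge k$. For a binary word $w$, the tumble operation is: choose a collection of non-overlapping factors (contiguous subwords) of $w$, each of the form $1^+0^+$ (one or more ones followed by one or more zeros), which together contain every occurrence of the factor $10$ in $w$, and reverse each chosen factor in place. $T(w)$ denotes the set of all words obtainable from $w$ by one tumble operation (over all valid choices of factors). -}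

module Defs where

open import Data.Bool using (Bool; true; false; if_then_else_)
open import Data.Nat using (ℕ; zero; suc; _+_; _≤_; _<ᵇ_; _≤ᵇ_)
open import Data.List using (List; []; _∷_; _++_; [_]; reverse; concat; concatMap; map; replicate; length)
open import Data.Product using (Σ; _×_; ∃; ∃-syntax)
open import Relation.Binary.PropositionalEquality using (_≡_)

-- Permutations are words (lists) over {1,…,n} in which each symbol occurs
-- exactly once, i.e. lists that are permutations of [1,…,n]
-- (stated with Data.List.Relation.Binary.Permutation.Propositional in Statement).

runs : List ℕ → List (List ℕ)
runs [] = []
runs (x ∷ xs) = addTo (runs xs)
  where
  addTo : List (List ℕ) → List (List ℕ)
  addTo [] = [ x ] ∷ []
  addTo ([] ∷ rs) = [ x ] ∷ rs
  addTo ((y ∷ r) ∷ rs) = if y <ᵇ x then (x ∷ y ∷ r) ∷ rs else [ x ] ∷ (y ∷ r) ∷ rs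

P : List ℕ → List ℕ
P π = concatMap reverse (runs π)

-- π|_k : letter is true (=1) iff π(i) ≥ k, false (=0) iff π(i) < k.
restrict : ℕ → List ℕ → List Bool
restrict k π = map (λ x → k ≤ᵇ x) π

-- A choice of non-overlapping factors of w is encoded as a segmentation of w
-- into single untouched letters and chosen factors 1^(a+1) 0^(b+1).
data Segment : Set where
  plain : Bool → Segment
  blk   : ℕ → ℕ → Segment

segWord : Segment → List Bool
segWord (plain x) = [ x ]
segWord (blk a b) = replicate (suc a) true ++ replicate (suc b) false

segOut : Segment → List Bool
segOut (plain x) = [ x ]
segOut (blk a b) = reverse (segWord (blk a b))

-- the occurrence of the factor 10 starting at position i (0-based) is
-- contained in some chosen factor
Covered : List Segment → ℕ → Set
Covered segs i =
  ∃[ s₁ ] ∃[ a ] ∃[ b ] ∃[ s₂ ]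
    (segs ≡ s₁ ++ blk a b ∷ s₂) ×
    (length (concatMap segWord s₁) ≤ i) ×
    (i + 2 ≤ length (concatMap segWord s₁) + (suc a + suc b))

InT : List Bool → List Bool → Set
InT w' w =
  ∃[ segs ]
    (concatMap segWord segs ≡ w) ×
    (∀ (u v : List Bool) → w ≡ u ++ true ∷ false ∷ v → Covered segs (length u)) ×
    (concatMap segOut segs ≡ w')

-- A maximal decreasing run restricts to a block 1ᵃ0ᵇ, and P reverses it to 0ᵇ1ᵃ, which is one
-- tumble of that block (a single chosen factor when a, b > 0, no factor otherwise).  Tumbles of
-- two words combine into a tumble of their concatenation unless a factor 10 straddles the
-- junction; between two maximal runs the last letter of the first is at most the first letter
-- of the second, so the restricted junction is never 10.
module Submission where

open import Defs
open import Data.Nat using (ℕ; suc; _≤_)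
open import Data.List using (List; applyUpTo)
open import Data.List.Relation.Binary.Permutation.Propositional using (_↭_)

open import Data.Bool using (Bool; true; false; T)
open import Data.Empty using (⊥-elim)
open import Data.List using ([]; _∷_; _++_; [_]; _∷ʳ_; concat; concatMap; length; map; replicate; reverse)
open import Data.List.Properties
  using (++-assoc; ++-identityʳ; ∷-injective; concatMap-++; length-++; length-replicate; map-++; reverse-map; unfold-reverse)
open import Data.List.Relation.Unary.All using (All; []; _∷_; lookupAny)
open import Data.List.Relation.Unary.Any using (Any; here; there)
open import Data.List.Relation.Unary.Linked using (Linked; []; [-]; _∷_)
open import Data.Nat using (zero; _+_; _>_; _<ᵇ_; _≤ᵇ_; z≤n)
open import Data.Nat.Properties
  using (≤-trans; <⇒≤; ≮⇒≥; +-assoc; +-monoʳ-≤; m≤m+n; ≤ᵇ⇒≤; ≤⇒≤ᵇ; ≤ᵇ-reflects-≤; <ᵇ-reflects-<)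
open import Data.Product using (∃; ∃₂; _×_; _,_; proj₁; proj₂; uncurry)
open import Data.Sum using (_⊎_; inj₁; inj₂)
open import Data.Unit using (⊤; tt)
open import Relation.Nullary using (¬_)
open import Relation.Nullary.Reflects using (ofʸ; ofⁿ)
open import Relation.Binary.PropositionalEquality
  using (_≡_; _≢_; refl; sym; trans; cong; cong₂; subst; subst₂)

module _ {A : Set} where

  replicate-∷ʳ : ∀ n (x : A) → replicate n x ∷ʳ x ≡ x ∷ replicate n x
  replicate-∷ʳ zero    x = refl
  replicate-∷ʳ (suc n) x = cong (x ∷_) (replicate-∷ʳ n x)

  reverse-replicate : ∀ n (x : A) → reverse (replicate n x) ≡ replicate n x
  reverse-replicate zero    x = refl
  reverse-replicate (suc n) x = trans (unfold-reverse x (replicate n x))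
    (trans (cong (_∷ʳ x) (reverse-replicate n x)) (replicate-∷ʳ n x))

  ++-adjacent : ∀ (xs : List A) {ys u x y v} → xs ++ ys ≡ u ++ x ∷ y ∷ v →
    (∃ λ v′ → xs ≡ u ++ x ∷ y ∷ v′) ⊎
    (xs ≡ u ∷ʳ x × ys ≡ y ∷ v) ⊎
    (∃ λ u′ → u ≡ xs ++ u′ × ys ≡ u′ ++ x ∷ y ∷ v)
  ++-adjacent []                     eq   = inj₂ (inj₂ (_ , refl , eq))
  ++-adjacent (_ ∷ [])     {u = []}  refl = inj₂ (inj₁ (refl , refl))
  ++-adjacent (_ ∷ _ ∷ xs) {u = []}  refl = inj₁ (xs , refl)
  ++-adjacent (a ∷ xs)     {u = _ ∷ u} eq with refl , eq′ ← ∷-injective eq with ++-adjacent xs eq′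
  ... | inj₁ (v′ , e)                 = inj₁ (v′ , cong (a ∷_) e)
  ... | inj₂ (inj₁ (e₁ , e₂))         = inj₂ (inj₁ (cong (a ∷_) e₁ , e₂))
  ... | inj₂ (inj₂ (u′ , e₁ , e₂))     = inj₂ (inj₂ (u′ , cong (a ∷_) e₁ , e₂))

  length-prefix+2≤ : ∀ {w} u {x y : A} {v} → w ≡ u ++ x ∷ y ∷ v → length u + 2 ≤ length w
  length-prefix+2≤ u {v = v} refl =
    subst (length u + 2 ≤_) (sym (length-++ u)) (+-monoʳ-≤ (length u) (m≤m+n 2 (length v)))

No10 : List Bool → Set
No10 w = ∀ u v → w ≢ u ++ true ∷ false ∷ v

Straddles10 : List Bool → List Bool → Set
Straddles10 w₁ w₂ = ∃₂ λ u v → w₁ ≡ u ∷ʳ true × w₂ ≡ false ∷ v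

width : List Segment → ℕ
width segs = length (concatMap segWord segs)

width-++ : ∀ s₁ s₂ → width (s₁ ++ s₂) ≡ width s₁ + width s₂
width-++ s₁ s₂ = trans (cong length (concatMap-++ segWord s₁ s₂)) (length-++ (concatMap segWord s₁))

Covered-++⁺ˡ : ∀ {s₁ s₂ i} → Covered s₁ i → Covered (s₁ ++ s₂) i
Covered-++⁺ˡ {s₂ = s₂} (t₁ , a , b , t₂ , refl , before , after) =
  t₁ , a , b , t₂ ++ s₂ , ++-assoc t₁ (blk a b ∷ t₂) s₂ , before , after

Covered-++⁺ʳ : ∀ s₁ {s₂ i} → Covered s₂ i → Covered (s₁ ++ s₂) (width s₁ + i)
Covered-++⁺ʳ s₁ {i = i} (t₁ , a , b , t₂ , refl , before , after) =
  s₁ ++ t₁ , a , b , t₂ , sym (++-assoc s₁ t₁ _) , before′ , after′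
  where
  before′ : width (s₁ ++ t₁) ≤ width s₁ + i
  before′ rewrite width-++ s₁ t₁ = +-monoʳ-≤ (width s₁) before
  after′ : width s₁ + i + 2 ≤ width (s₁ ++ t₁) + (suc a + suc b)
  after′ rewrite width-++ s₁ t₁ | +-assoc (width s₁) i 2 | +-assoc (width s₁) (width t₁) (suc a + suc b) =
    +-monoʳ-≤ (width s₁) after

concatMap-plain : (f : Segment → List Bool) → (∀ x → f (plain x) ≡ [ x ]) →
  ∀ w → concatMap f (map plain w) ≡ w
concatMap-plain f f-plain []      = refl
concatMap-plain f f-plain (x ∷ w) = cong₂ _++_ (f-plain x) (concatMap-plain f f-plain w)

InT-refl : ∀ w → No10 w → InT w w
InT-refl w no10 =
  map plain w , concatMap-plain segWord (λ _ → refl) w ,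
  (λ u v eq → ⊥-elim (no10 u v eq)) , concatMap-plain segOut (λ _ → refl) w

InT-++ : ∀ {w₁′ w₁ w₂′ w₂} → InT w₁′ w₁ → InT w₂′ w₂ → ¬ Straddles10 w₁ w₂ →
  InT (w₁′ ++ w₂′) (w₁ ++ w₂)
InT-++ (s₁ , refl , covered₁ , refl) (s₂ , refl , covered₂ , refl) no-straddle =
  s₁ ++ s₂ , concatMap-++ segWord s₁ s₂ , covered , concatMap-++ segOut s₁ s₂
  where
  covered : ∀ u v → concatMap segWord s₁ ++ concatMap segWord s₂ ≡ u ++ true ∷ false ∷ v →
    Covered (s₁ ++ s₂) (length u)
  covered u v eq with ++-adjacent (concatMap segWord s₁) eq
  ... | inj₁ (v′ , e)              = Covered-++⁺ˡ (covered₁ u v′ e)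
  ... | inj₂ (inj₁ (e₁ , e₂))      = ⊥-elim (no-straddle (u , v , e₁ , e₂))
  ... | inj₂ (inj₂ (u′ , refl , e)) =
    subst (Covered (s₁ ++ s₂)) (sym (length-++ (concatMap segWord s₁))) (Covered-++⁺ʳ s₁ (covered₂ u′ v e))

replicate-No10 : ∀ n x → No10 (replicate n x)
replicate-No10 zero          x     []      v ()
replicate-No10 zero          x     (_ ∷ _) v ()
replicate-No10 (suc zero)    x     []      v ()
replicate-No10 (suc (suc n)) true  []      v ()
replicate-No10 (suc (suc n)) false []      v ()
replicate-No10 (suc n)       x     (_ ∷ u) v eq = replicate-No10 n x u v (proj₂ (∷-injective eq))

tumble-constant : ∀ n x → InT (reverse (replicate n x)) (replicate n x)
tumble-constant n x =
  subst (λ w → InT w (replicate n x)) (sym (reverse-replicate n x)) (InT-refl _ (replicate-No10 n x))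

tumble-block : ∀ a b →
  InT (reverse (replicate a true ++ replicate b false)) (replicate a true ++ replicate b false)
tumble-block (suc a) (suc b) = blk a b ∷ [] , ++-identityʳ _ , covered , ++-identityʳ _
  where
  block-length : length (replicate (suc a) true ++ replicate (suc b) false) ≡ suc a + suc b
  block-length = trans (length-++ (replicate (suc a) true))
                       (cong₂ _+_ (length-replicate (suc a)) (length-replicate (suc b)))
  covered : ∀ u v → replicate (suc a) true ++ replicate (suc b) false ≡ u ++ true ∷ false ∷ v →
    Covered (blk a b ∷ []) (length u)
  covered u v eq = [] , a , b , [] , refl , z≤n , subst (length u + 2 ≤_) block-length (length-prefix+2≤ u eq)
tumble-block a zero =
  subst (λ w → InT (reverse w) w) (sym (++-identityʳ (replicate a true))) (tumble-constant a true)
tumble-block zero (suc b) = tumble-constant (suc b) false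

restrict-decreasing : ∀ k {r} → Linked _>_ r → ∃₂ λ a b → restrict k r ≡ replicate a true ++ replicate b false
restrict-decreasing k [] = 0 , 0 , refl
restrict-decreasing k ([-] {x}) with k ≤ᵇ x
... | true  = 1 , 0 , refl
... | false = 0 , 1 , refl
restrict-decreasing k (_∷_ {x} {y} y<x dec) with restrict-decreasing k dec | k ≤ᵇ x | ≤ᵇ-reflects-≤ k x
... | a , b , eq     | true  | _       = suc a , b , cong (true ∷_) eq
... | zero , b , eq  | false | _       = 0 , suc b , cong (false ∷_) eq
... | suc a , b , eq | false | ofⁿ k≰x = ⊥-elim (k≰x (≤-trans k≤y (<⇒≤ y<x)))
  where
  k≤y : k ≤ y
  k≤y = ≤ᵇ⇒≤ k y (subst T (sym (proj₁ (∷-injective eq))) tt)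

decreasing-last≥⇒all≥ : ∀ k {r u} → Linked _>_ r → restrict k r ≡ u ∷ʳ true → All (k ≤_) r
decreasing-last≥⇒all≥ k {u = []}        [] ()
decreasing-last≥⇒all≥ k {u = _ ∷ _}     [] ()
decreasing-last≥⇒all≥ k {u = []}        ([-] {x}) eq with k ≤ᵇ x | ≤ᵇ-reflects-≤ k x
decreasing-last≥⇒all≥ k {u = []}        [-] refl | true | ofʸ k≤x = k≤x ∷ []
decreasing-last≥⇒all≥ k {u = _ ∷ []}    [-] ()
decreasing-last≥⇒all≥ k {u = _ ∷ _ ∷ _} [-] ()
decreasing-last≥⇒all≥ k {u = []}        (_ ∷ _) ()
decreasing-last≥⇒all≥ k {u = _ ∷ u}     (y<x ∷ dec) eq
  with k≤y ∷ k≤rest ← decreasing-last≥⇒all≥ k dec (proj₂ (∷-injective eq)) =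
  ≤-trans k≤y (<⇒≤ y<x) ∷ k≤y ∷ k≤rest

-- For a decreasing r, some letter of r is ≤ y exactly when its last letter is.
NoDescentBetween : List ℕ → List ℕ → Set
NoDescentBetween r []      = ⊤
NoDescentBetween r (y ∷ _) = Any (_≤ y) r

NoDescentBetween-∷ˡ : ∀ {x r} s → NoDescentBetween r s → NoDescentBetween (x ∷ r) s
NoDescentBetween-∷ˡ []      _  = tt
NoDescentBetween-∷ˡ (_ ∷ _) nd = there nd

data MaximalRuns : List (List ℕ) → Set where
  []  : MaximalRuns []
  run : ∀ {x r rs} → Linked _>_ (x ∷ r) → NoDescentBetween (x ∷ r) (concat rs) →
        MaximalRuns rs → MaximalRuns ((x ∷ r) ∷ rs)

concat-runs : ∀ xs → concat (runs xs) ≡ xs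
concat-runs [] = refl
concat-runs (x ∷ xs) with runs xs | concat-runs xs
... | []             | ih = cong (x ∷_) ih
... | [] ∷ rs        | ih = cong (x ∷_) ih
... | (y ∷ r) ∷ rs   | ih with y <ᵇ x
...   | true  = cong (x ∷_) ih
...   | false = cong (x ∷_) ih

runs-maximal : ∀ xs → MaximalRuns (runs xs)
runs-maximal [] = []
runs-maximal (x ∷ xs) with runs xs | runs-maximal xs
... | []           | [] = run [-] tt []
... | (y ∷ r) ∷ rs | run dec nd rest with y <ᵇ x | <ᵇ-reflects-< y x
...   | true  | ofʸ y<x = run (y<x ∷ dec) (NoDescentBetween-∷ˡ (concat rs) nd) rest
...   | false | ofⁿ y≮x = run [-] (here (≮⇒≥ y≮x)) (run dec nd rest)

no10-across-runs : ∀ k {r s} → Linked _>_ r → NoDescentBetween r s →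
  ¬ Straddles10 (restrict k r) (restrict k s)
no10-across-runs k {s = []}    dec nd (_ , _ , _ , ())
no10-across-runs k {s = y ∷ s} dec nd (_ , _ , ends , starts) =
  subst T (proj₁ (∷-injective starts))
    (≤⇒≤ᵇ (uncurry ≤-trans (lookupAny (decreasing-last≥⇒all≥ k dec ends) nd)))

tumble-decreasing : ∀ k {r} → Linked _>_ r → InT (restrict k (reverse r)) (restrict k r)
tumble-decreasing k {r} dec with restrict-decreasing k dec
... | a , b , eq =
  subst (λ w → InT w (restrict k r)) (sym (reverse-map _ r))
    (subst (λ w → InT (reverse w) w) (sym eq) (tumble-block a b))

tumble-runs : ∀ k {rs} → MaximalRuns rs → InT (restrict k (concatMap reverse rs)) (restrict k (concat rs))
tumble-runs k [] = InT-refl [] λ { [] _ () ; (_ ∷ _) _ () }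
tumble-runs k (run {x} {r} {rs} dec nd rest) =
  subst₂ InT (sym (map-++ _ (reverse (x ∷ r)) (concatMap reverse rs))) (sym (map-++ _ (x ∷ r) (concat rs)))
    (InT-++ (tumble-decreasing k dec) (tumble-runs k rest) (no10-across-runs k dec nd))

-- The statement holds for every word over ℕ and every k.
proposition2p1 : (n : ℕ) (π : List ℕ) → π ↭ applyUpTo suc n →
    (k : ℕ) → k ≤ n → InT (restrict k (P π)) (restrict k π)
proposition2p1 _ π _ k _ =
  subst (InT (restrict k (P π))) (cong (restrict k) (concat-runs π)) (tumble-runs k (runs-maximal π))
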